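{- Let $F_2$ be the free group on two generators. For every integer $n \in \mathbb{Z}$ there exists a finite subset $A_n \subseteq F_2$ such that $|A_nA_n^{ -1}| - |A_n^{ -1}A_n| = 2n$.
   Context: For a finite subset $A$ of a group $G$, the right quotient set is $AA^{ -1} = \{a b^{ -1} : a, b \in A\}$ and the left quotient set is $A^{ -1}A = \{a^{ -1} b : a, b \in A\}$. -}

module Defs where

open import Data.Bool using (Bool; true; false; not; _∧_; T)
open import Data.Fin using (Fin)
import Data.Fin.Properties as FinP
import Data.Bool.Properties as BoolP
open import Data.Product using (Σ; _×_; _,_; proj₁; proj₂)
import Data.Product.Properties as ProdP
open import Data.List using (List; []; _∷_; _++_; reverse; map; length; deduplicate; cartesianProductWith)
import Data.List.Properties as ListP
open import Data.List.Relation.Unary.All using (All)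
open import Data.Nat using (ℕ)
open import Relation.Binary.PropositionalEquality using (_≡_; refl)
open import Relation.Binary.Definitions using (DecidableEquality)
open import Relation.Nullary using (yes; no)

-- A letter: a generator (index in Fin 2) together with an exponent sign
-- (true = +1, false = -1).  The free group F₂ = ⟨ x₀ , x₁ ⟩.
Letter : Set
Letter = Fin 2 × Bool

_≟L_ : DecidableEquality Letter
_≟L_ = ProdP.≡-dec FinP._≟_ BoolP._≟_

invL : Letter → Letter
invL (i , s) = (i , not s)

Word : Set
Word = List Letter

_≟W_ : DecidableEquality Word
_≟W_ = ListP.≡-dec _≟L_

push : Letter → Word → Word
push l [] = l ∷ []
push l (m ∷ w) with invL l ≟L m
... | yes _ = w
... | no  _ = l ∷ m ∷ w

reduce : Word → Word
reduce [] = []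
reduce (l ∷ w) = push l (reduce w)

-- Elements of F₂ are represented by their unique freely reduced words:
-- a word w is an element of F₂ iff  reduce w ≡ w.
IsReduced : Word → Set
IsReduced w = reduce w ≡ w

_·_ : Word → Word → Word
u · v = reduce (u ++ v)

_⁻¹ : Word → Word
w ⁻¹ = reverse (map invL w)

-- A finite subset of F₂ is given by a list of reduced words
-- (repetitions allowed; cardinalities are computed after deduplication).
FinSubsetF₂ : Set
FinSubsetF₂ = Σ (List Word) (All IsReduced)

card : List Word → ℕ
card ws = length (deduplicate _≟W_ ws)

rightQuot : List Word → List Word
rightQuot A = cartesianProductWith (λ a b → a · (b ⁻¹)) A A

leftQuot : List Word → List Word
leftQuot A = cartesianProductWith (λ a b → (a ⁻¹) · b) A A

-- Take A = {1, x⁻¹} ∪ {xⁱy : 0 ≤ i ≤ m}. In reduced words, A A⁻¹ consists of the xᵏ with ∣ k ∣ ≤ m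
-- and of y⁻¹x⁻ʲ, x⁻¹y⁻¹x⁻ʲ, xⁱy, xⁱyx for 0 ≤ i, j ≤ m: 6m + 5 elements.  A⁻¹ A consists of 1, x, x⁻¹,
-- of xⁱy and y⁻¹x⁻ⁱ for 0 ≤ i ≤ m + 1, and of y⁻¹xᵏy for 0 < ∣ k ∣ ≤ m: 4m + 7 elements.  The difference
-- 2(m − 1) takes every value 2n with n ≥ 0, and A⁻¹ swaps the two quotient sets, giving n < 0.
-- The listed words are distinct because they differ in the signs of their y-letters or in the lengths
-- of their x-blocks.
module Submission where

open import Data.Bool using (Bool; true; false; not)
open import Data.Fin using (zero; suc)
open import Data.Integer as ℤ using (ℤ; +_; -[1+_]; +[1+_]; _+_; _-_; _*_; -_; _⊖_; ∣_∣)
import Data.Integer.Properties as ℤ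
open import Data.List
  using (List; []; _∷_; _++_; length; replicate; map; reverse; upTo; concat; cartesianProductWith; head)
import Data.List.Properties as List
open import Data.List.Membership.Propositional using (_∈_)
open import Data.List.Membership.Propositional.Properties
  using (∈-map⁺; ∈-map⁻; ∈-++⁺ˡ; ∈-++⁺ʳ; ∈-++⁻; ∈-upTo⁺; ∈-upTo⁻; ∈-concat⁺′; ∈-concat⁻;
         ∈-cartesianProductWith⁺; ∈-cartesianProductWith⁻; ∈-deduplicate⁺; ∈-deduplicate⁻)
open import Data.List.Membership.Propositional.Properties.WithK using (unique∧set⇒bag)
open import Data.List.Relation.Binary.BagAndSetEquality using (∼bag⇒↭)
open import Data.List.Relation.Binary.Disjoint.Propositional using (Disjoint)
open import Data.List.Relation.Binary.Permutation.Propositional.Properties using (↭-length)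
open import Data.List.Relation.Unary.All as All using (All; []; _∷_)
import Data.List.Relation.Unary.All.Properties as All
open import Data.List.Relation.Unary.AllPairs using ([]; _∷_)
open import Data.List.Relation.Unary.Any using (Any; here; there)
open import Data.List.Relation.Unary.Unique.Propositional using (Unique)
import Data.List.Relation.Unary.Unique.Propositional.Properties as Unique
open import Data.Nat as ℕ using (ℕ; zero; suc; _≤_; _<_; z≤n; s≤s)
open import Data.Nat.ListAction using (sum)
import Data.Nat.Properties as ℕ
open import Data.Nat.Tactic.RingSolver using (solve-∀)
open import Data.Product using (Σ; ∃₂; _×_; _,_; proj₁; proj₂)
open import Data.Sum using (inj₁; inj₂)
open import Function using (case_of_)
open import Function.Bundles using (mk⇔)
open import Relation.Binary.PropositionalEquality
  using (_≡_; _≢_; refl; sym; trans; cong; cong₂; subst; module ≡-Reasoning)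
open import Relation.Nullary using (contradiction)

open import Defs
open import Data.List.Relation.Unary.Unique.DecPropositional.Properties _≟W_ using (deduplicate-!)

open ≡-Reasoning

xˢ yˢ : Bool → Letter
xˢ s = zero , s
yˢ s = suc zero , s

x^ : ℤ → Word
x^ (+ n) = replicate n (xˢ true)
x^ -[1+ n ] = replicate (suc n) (xˢ false)

ySigns : Word → List Bool
ySigns [] = []
ySigns ((zero , _) ∷ w) = ySigns w
ySigns ((suc _ , s) ∷ w) = s ∷ ySigns w

ySigns-++ : ∀ u v → ySigns (u ++ v) ≡ ySigns u ++ ySigns v
ySigns-++ [] v = refl
ySigns-++ ((zero , _) ∷ u) v = ySigns-++ u v
ySigns-++ ((suc _ , s) ∷ u) v = cong (s ∷_) (ySigns-++ u v)

ySigns-x^ : ∀ a → ySigns (x^ a) ≡ []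
ySigns-x^ (+ zero) = refl
ySigns-x^ (+ suc n) = ySigns-x^ (+ n)
ySigns-x^ -[1+ zero ] = refl
ySigns-x^ -[1+ suc n ] = ySigns-x^ -[1+ n ]

x^-injective : ∀ {a b} → x^ a ≡ x^ b → a ≡ b
x^-injective {+ m} {+ n} eq =
  cong +_ (trans (sym (List.length-replicate m)) (trans (cong length eq) (List.length-replicate n)))
x^-injective { -[1+ m ]} { -[1+ n ]} eq =
  cong -[1+_] (cong ℕ.pred (trans (sym (List.length-replicate (suc m)))
                                  (trans (cong length eq) (List.length-replicate (suc n)))))
x^-injective {+ zero} { -[1+ n ]} ()
x^-injective {+ suc m} { -[1+ n ]} ()
x^-injective { -[1+ m ]} {+ zero} ()
x^-injective { -[1+ m ]} {+ suc n} ()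

-- The omitted clauses, where u or u′ starts with a y-letter, are absurd since ySigns is then nonempty.
split-at-y : ∀ {u u′ v v′ s s′} → ySigns u ≡ [] → ySigns u′ ≡ [] →
             u ++ yˢ s ∷ v ≡ u′ ++ yˢ s′ ∷ v′ → u ≡ u′ × s ≡ s′ × v ≡ v′
split-at-y {[]} {[]} _ _ refl = refl , refl , refl
split-at-y {[]} {(zero , _) ∷ _} _ _ ()
split-at-y {(zero , _) ∷ _} {[]} _ _ ()
split-at-y {(zero , b) ∷ u} {(zero , b′) ∷ u′} noY noY′ eq with refl ← cong head eq
  with u≡u′ , s≡s′ , v≡v′ ← split-at-y {u} {u′} noY noY′ (List.∷-injectiveʳ eq) =
  cong (_ ∷_) u≡u′ , s≡s′ , v≡v′

data NoLeadingX : Word → Set where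
  []  : NoLeadingX []
  y∷_ : ∀ {s} w → NoLeadingX (yˢ s ∷ w)

±1 : Bool → ℤ
±1 true = + 1
±1 false = -[1+ 0 ]

push-x^ : ∀ s a {w} → NoLeadingX w → push (xˢ s) (x^ a ++ w) ≡ x^ (±1 s + a) ++ w
push-x^ true (+ zero) [] = refl
push-x^ true (+ zero) (y∷ _) = refl
push-x^ true (+ suc n) _ = refl
push-x^ true -[1+ zero ] _ = refl
push-x^ true -[1+ suc n ] _ = refl
push-x^ false (+ zero) [] = refl
push-x^ false (+ zero) (y∷ _) = refl
push-x^ false (+ suc zero) _ = refl
push-x^ false (+ suc (suc n)) _ = refl
push-x^ false -[1+ n ] _ = refl

push-y-x^ : ∀ s a → push (yˢ s) (x^ a) ≡ yˢ s ∷ x^ a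
push-y-x^ s (+ zero) = refl
push-y-x^ s (+ suc n) = refl
push-y-x^ s -[1+ n ] = refl

reduce-x^-++-x^ : ∀ a {b v w} → NoLeadingX w → reduce v ≡ x^ b ++ w → reduce (x^ a ++ v) ≡ x^ (a + b) ++ w
reduce-x^-++-x^ (+ zero) {b} _ eq = trans eq (cong (λ k → x^ k ++ _) (sym (ℤ.+-identityˡ b)))
reduce-x^-++-x^ (+ suc n) {b} {v} {w} nx eq = begin
  push (xˢ true) (reduce (x^ (+ n) ++ v)) ≡⟨ cong (push _) (reduce-x^-++-x^ (+ n) {b} nx eq) ⟩
  push (xˢ true) (x^ (+ n + b) ++ w)      ≡⟨ push-x^ true (+ n + b) nx ⟩
  x^ (+ 1 + (+ n + b)) ++ w               ≡⟨ cong (λ k → x^ k ++ w) (ℤ.+-assoc (+ 1) (+ n) b) ⟨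
  x^ (+ suc n + b) ++ w                   ∎
reduce-x^-++-x^ -[1+ zero ] {b} nx eq = trans (cong (push _) eq) (push-x^ false b nx)
reduce-x^-++-x^ -[1+ suc n ] {b} {v} {w} nx eq = begin
  push (xˢ false) (reduce (x^ -[1+ n ] ++ v)) ≡⟨ cong (push _) (reduce-x^-++-x^ -[1+ n ] {b} nx eq) ⟩
  push (xˢ false) (x^ (-[1+ n ] + b) ++ w)    ≡⟨ push-x^ false (-[1+ n ] + b) nx ⟩
  x^ (-[1+ 0 ] + (-[1+ n ] + b)) ++ w         ≡⟨ cong (λ k → x^ k ++ w) (ℤ.+-assoc -[1+ 0 ] -[1+ n ] b) ⟨
  x^ (-[1+ suc n ] + b) ++ w                  ∎

reduce-x^-++ : ∀ a {v w} → NoLeadingX w → reduce v ≡ w → reduce (x^ a ++ v) ≡ x^ a ++ w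
reduce-x^-++ a {w = w} nx eq = trans (reduce-x^-++-x^ a {+ 0} nx eq) (cong (λ k → x^ k ++ w) (ℤ.+-identityʳ a))

x^-reduced : ∀ a → IsReduced (x^ a)
x^-reduced a = subst IsReduced (List.++-identityʳ (x^ a)) (reduce-x^-++ a [] refl)

y∷x^-reduced : ∀ s a → IsReduced (yˢ s ∷ x^ a)
y∷x^-reduced s a = trans (cong (push (yˢ s)) (x^-reduced a)) (push-y-x^ s a)

⁻¹-++ : ∀ u v → (u ++ v) ⁻¹ ≡ v ⁻¹ ++ u ⁻¹
⁻¹-++ u v = trans (cong reverse (List.map-++ invL u v)) (List.reverse-++ (map invL u) (map invL v))

invL-involutive : ∀ l → invL (invL l) ≡ l
invL-involutive (i , true) = refl
invL-involutive (i , false) = refl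

⁻¹-involutive : ∀ w → w ⁻¹ ⁻¹ ≡ w
⁻¹-involutive w = begin
  reverse (map invL (reverse (map invL w))) ≡⟨ cong reverse (List.reverse-map invL (map invL w)) ⟩
  reverse (reverse (map invL (map invL w))) ≡⟨ List.reverse-involutive _ ⟩
  map invL (map invL w)                     ≡⟨ List.map-∘ w ⟨
  map (λ l → invL (invL l)) w               ≡⟨ List.map-cong invL-involutive w ⟩
  map (λ l → l) w                           ≡⟨ List.map-id w ⟩
  w                                         ∎

replicate-⁻¹ : ∀ n l → replicate n l ⁻¹ ≡ replicate n (invL l)
replicate-⁻¹ zero l = refl
replicate-⁻¹ (suc n) l = begin
  (l ∷ replicate n l) ⁻¹               ≡⟨ ⁻¹-++ (l ∷ []) (replicate n l) ⟩
  replicate n l ⁻¹ ++ invL l ∷ []      ≡⟨ cong (_++ invL l ∷ []) (replicate-⁻¹ n l) ⟩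
  replicate n (invL l) ++ invL l ∷ []  ≡⟨ replicate-∷ʳ n ⟩
  replicate (suc n) (invL l)           ∎
  where
  replicate-∷ʳ : ∀ {a : Letter} k → replicate k a ++ a ∷ [] ≡ a ∷ replicate k a
  replicate-∷ʳ zero = refl
  replicate-∷ʳ (suc k) = cong (_ ∷_) (replicate-∷ʳ k)

x^-⁻¹ : ∀ a → x^ a ⁻¹ ≡ x^ (- a)
x^-⁻¹ (+ zero) = refl
x^-⁻¹ (+ suc n) = replicate-⁻¹ (suc n) (xˢ true)
x^-⁻¹ -[1+ n ] = replicate-⁻¹ (suc n) (xˢ false)

-- ⟦ yxy 0 ⟧ = y⁻¹y is not reduced: yConj k is the normal form of y⁻¹xᵏy.
data Elt : Set where
  xPow : ℤ → Elt
  xyx  : ℤ → Bool → ℤ → Elt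
  yxy  : ℤ → Elt

⟦_⟧ : Elt → Word
⟦ xPow a ⟧ = x^ a
⟦ xyx a s b ⟧ = x^ a ++ yˢ s ∷ x^ b
⟦ yxy a ⟧ = yˢ false ∷ x^ a ++ yˢ true ∷ []

yConj : ℤ → Elt
yConj (+ zero) = xPow (+ 0)
yConj +[1+ n ] = yxy +[1+ n ]
yConj -[1+ n ] = yxy -[1+ n ]

yPattern : Elt → List Bool
yPattern (xPow _) = []
yPattern (xyx _ s _) = s ∷ []
yPattern (yxy _) = false ∷ true ∷ []

ySigns-⟦⟧ : ∀ e → ySigns ⟦ e ⟧ ≡ yPattern e
ySigns-⟦⟧ (xPow a) = ySigns-x^ a
ySigns-⟦⟧ (xyx a s b) = begin
  ySigns (x^ a ++ yˢ s ∷ x^ b)        ≡⟨ ySigns-++ (x^ a) _ ⟩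
  ySigns (x^ a) ++ s ∷ ySigns (x^ b)  ≡⟨ cong₂ (λ u v → u ++ s ∷ v) (ySigns-x^ a) (ySigns-x^ b) ⟩
  s ∷ []                              ∎
ySigns-⟦⟧ (yxy a) = cong (false ∷_) (trans (ySigns-++ (x^ a) _) (cong (_++ true ∷ []) (ySigns-x^ a)))

⟦⟧-injective : ∀ {e f} → ⟦ e ⟧ ≡ ⟦ f ⟧ → e ≡ f
⟦⟧-injective {e} {f} eq = injective e f (trans (sym (ySigns-⟦⟧ e)) (trans (cong ySigns eq) (ySigns-⟦⟧ f))) eq
  where
  injective : ∀ e f → yPattern e ≡ yPattern f → ⟦ e ⟧ ≡ ⟦ f ⟧ → e ≡ f
  injective (xPow a) (xPow b) _ eq = cong xPow (x^-injective eq)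
  injective (xyx a s b) (xyx a′ s′ b′) _ eq with a≡a′ , refl , b≡b′ ← split-at-y (ySigns-x^ a) (ySigns-x^ a′) eq =
    cong₂ (λ a b → xyx a s b) (x^-injective a≡a′) (x^-injective b≡b′)
  injective (yxy a) (yxy b) _ eq with a≡b , _ ← split-at-y (ySigns-x^ a) (ySigns-x^ b) (List.∷-injectiveʳ eq) =
    cong yxy (x^-injective a≡b)
  injective (xPow _) (xyx _ _ _) () _
  injective (xPow _) (yxy _) () _
  injective (xyx _ _ _) (xPow _) () _
  injective (xyx _ _ _) (yxy _) () _
  injective (yxy _) (xPow _) () _
  injective (yxy _) (xyx _ _ _) () _

xyx-reduced : ∀ a s b → IsReduced ⟦ xyx a s b ⟧
xyx-reduced a s b = reduce-x^-++ a (y∷ _) (y∷x^-reduced s b)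

xyx-⁻¹ : ∀ a s b → ⟦ xyx a s b ⟧ ⁻¹ ≡ ⟦ xyx (- b) (not s) (- a) ⟧
xyx-⁻¹ a s b = begin
  (x^ a ++ yˢ s ∷ x^ b) ⁻¹                   ≡⟨ ⁻¹-++ (x^ a) _ ⟩
  (yˢ s ∷ x^ b) ⁻¹ ++ x^ a ⁻¹                ≡⟨ cong (_++ x^ a ⁻¹) (⁻¹-++ (yˢ s ∷ []) (x^ b)) ⟩
  (x^ b ⁻¹ ++ yˢ (not s) ∷ []) ++ x^ a ⁻¹    ≡⟨ List.++-assoc (x^ b ⁻¹) _ _ ⟩
  x^ b ⁻¹ ++ yˢ (not s) ∷ x^ a ⁻¹            ≡⟨ cong₂ (λ u v → u ++ yˢ (not s) ∷ v) (x^-⁻¹ b) (x^-⁻¹ a) ⟩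
  x^ (- b) ++ yˢ (not s) ∷ x^ (- a)          ∎

xPow-·-xPow : ∀ a b → ⟦ xPow a ⟧ · ⟦ xPow b ⟧ ≡ ⟦ xPow (a + b) ⟧
xPow-·-xPow a b = begin
  reduce (x^ a ++ x^ b)  ≡⟨ reduce-x^-++-x^ a [] (trans (x^-reduced b) (sym (List.++-identityʳ (x^ b)))) ⟩
  x^ (a + b) ++ []       ≡⟨ List.++-identityʳ _ ⟩
  x^ (a + b)             ∎

xPow-·-xyx : ∀ a b s c → ⟦ xPow a ⟧ · ⟦ xyx b s c ⟧ ≡ ⟦ xyx (a + b) s c ⟧
xPow-·-xyx a b s c = reduce-x^-++-x^ a (y∷ _) (xyx-reduced b s c)

xyx-·-xPow : ∀ a s b c → ⟦ xyx a s b ⟧ · ⟦ xPow c ⟧ ≡ ⟦ xyx a s (b + c) ⟧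
xyx-·-xPow a s b c = begin
  reduce ((x^ a ++ yˢ s ∷ x^ b) ++ x^ c)  ≡⟨ cong reduce (List.++-assoc (x^ a) _ (x^ c)) ⟩
  reduce (x^ a ++ yˢ s ∷ x^ b ++ x^ c)    ≡⟨ reduce-x^-++ a (y∷ _) y·x^b+c ⟩
  x^ a ++ yˢ s ∷ x^ (b + c)               ∎
  where
  y·x^b+c : reduce (yˢ s ∷ x^ b ++ x^ c) ≡ yˢ s ∷ x^ (b + c)
  y·x^b+c = trans (cong (push (yˢ s)) (xPow-·-xPow b c)) (push-y-x^ s (b + c))

xy-·-y⁻¹x : ∀ a s b → ⟦ xyx a s (+ 0) ⟧ · ⟦ xyx (+ 0) (not s) b ⟧ ≡ ⟦ xPow (a + b) ⟧
xy-·-y⁻¹x a s b = begin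
  reduce ((x^ a ++ yˢ s ∷ []) ++ yˢ (not s) ∷ x^ b)  ≡⟨ cong reduce (List.++-assoc (x^ a) _ _) ⟩
  reduce (x^ a ++ yˢ s ∷ yˢ (not s) ∷ x^ b)          ≡⟨ reduce-x^-++-x^ a [] cancel ⟩
  x^ (a + b) ++ []                                    ≡⟨ List.++-identityʳ _ ⟩
  x^ (a + b)                                          ∎
  where
  cancel : reduce (yˢ s ∷ yˢ (not s) ∷ x^ b) ≡ x^ b ++ []
  cancel = begin
    push (yˢ s) (reduce (yˢ (not s) ∷ x^ b))  ≡⟨ cong (push (yˢ s)) (y∷x^-reduced (not s) b) ⟩
    push (yˢ s) (yˢ (not s) ∷ x^ b)           ≡⟨ push-y-y⁻¹ s ⟩
    x^ b                                      ≡⟨ List.++-identityʳ (x^ b) ⟨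
    x^ b ++ []                                ∎
    where
    push-y-y⁻¹ : ∀ s → push (yˢ s) (yˢ (not s) ∷ x^ b) ≡ x^ b
    push-y-y⁻¹ true = refl
    push-y-y⁻¹ false = refl

y⁻¹x-·-xy : ∀ a b → ⟦ xyx (+ 0) false a ⟧ · ⟦ xyx b true (+ 0) ⟧ ≡ ⟦ yConj (a + b) ⟧
y⁻¹x-·-xy a b = begin
  push (yˢ false) (reduce (x^ a ++ x^ b ++ yˢ true ∷ []))
    ≡⟨ cong (push _) (reduce-x^-++-x^ a (y∷ []) (xyx-reduced b true (+ 0))) ⟩
  push (yˢ false) (x^ (a + b) ++ yˢ true ∷ [])
    ≡⟨ push-y⁻¹ (a + b) ⟩
  ⟦ yConj (a + b) ⟧
    ∎
  where
  push-y⁻¹ : ∀ k → push (yˢ false) (x^ k ++ yˢ true ∷ []) ≡ ⟦ yConj k ⟧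
  push-y⁻¹ (+ zero) = refl
  push-y⁻¹ +[1+ n ] = refl
  push-y⁻¹ -[1+ n ] = refl

card-≡-length : ∀ ws {E} → Unique E → (∀ {z} → z ∈ ws → z ∈ E) → (∀ {z} → z ∈ E → z ∈ ws) →
                card ws ≡ length E
card-≡-length ws uE ws⊆E E⊆ws = ↭-length (∼bag⇒↭ (unique∧set⇒bag (deduplicate-! ws) uE
  (mk⇔ (λ p → ws⊆E (∈-deduplicate⁻ _≟W_ ws p)) (λ p → ∈-deduplicate⁺ _≟W_ (E⊆ws p)))))

Disjoint-on : ∀ {A B : Set} (t : A → B) {b c xs ys} →
              All (λ z → t z ≡ b) xs → All (λ z → t z ≡ c) ys → b ≢ c → Disjoint xs ys
Disjoint-on t txs tys b≢c (z∈xs , z∈ys) = b≢c (trans (sym (All.lookup txs z∈xs)) (All.lookup tys z∈ys))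

All-map⁺ : ∀ {A B : Set} {P : B → Set} (f : A → B) → (∀ a → P (f a)) → ∀ xs → All P (map f xs)
All-map⁺ f Pf xs = All.map⁺ (All.universal Pf xs)

module _ {A B C : Set} where

  All-cartesianProductWith⁺ : ∀ {P : C → Set} (f : A → B → C) → (∀ a b → P (f a b)) →
                              ∀ xs ys → All P (cartesianProductWith f xs ys)
  All-cartesianProductWith⁺ {P} f Pf xs ys = All.tabulate λ p →
    let a , b , _ , _ , eq = ∈-cartesianProductWith⁻ f xs ys p in subst P (sym eq) (Pf a b)

  length-cartesianProductWith : ∀ (f : A → B → C) xs ys →
                                length (cartesianProductWith f xs ys) ≡ length xs ℕ.* length ys
  length-cartesianProductWith f [] ys = refl
  length-cartesianProductWith f (a ∷ xs) ys = begin
    length (map (f a) ys ++ cartesianProductWith f xs ys)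
      ≡⟨ List.length-++ (map (f a) ys) ⟩
    length (map (f a) ys) ℕ.+ length (cartesianProductWith f xs ys)
      ≡⟨ cong₂ ℕ._+_ (List.length-map (f a) ys) (length-cartesianProductWith f xs ys) ⟩
    length ys ℕ.+ length xs ℕ.* length ys
      ∎

  cartesianProductWith-map : ∀ {f : B → B → C} {g : A → B} {h : A → A → C} → (∀ a b → f (g a) (g b) ≡ h a b) →
                             ∀ xs ys → cartesianProductWith f (map g xs) (map g ys) ≡ cartesianProductWith h xs ys
  cartesianProductWith-map fg≗h [] ys = refl
  cartesianProductWith-map fg≗h (a ∷ xs) ys =
    cong₂ _++_ (trans (sym (List.map-∘ ys)) (List.map-cong (fg≗h a) ys)) (cartesianProductWith-map fg≗h xs ys)

  ∈-cartesianProductWith-map⁻ : ∀ {f : B → B → C} {g : A → B} xs ys {z} →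
                                z ∈ cartesianProductWith f (map g xs) (map g ys) →
                                ∃₂ λ a b → a ∈ xs × b ∈ ys × z ≡ f (g a) (g b)
  ∈-cartesianProductWith-map⁻ {f} {g} xs ys p
    with _ , _ , ga∈ , gb∈ , refl ← ∈-cartesianProductWith⁻ f (map g xs) (map g ys) p
    with a , a∈ , refl ← ∈-map⁻ g ga∈
    with b , b∈ , refl ← ∈-map⁻ g gb∈ = a , b , a∈ , b∈ , refl

length-concat : ∀ {A : Set} (xss : List (List A)) → length (concat xss) ≡ sum (map length xss)
length-concat [] = refl
length-concat (xs ∷ xss) = trans (List.length-++ xs) (cong (length xs ℕ.+_) (length-concat xss))

punctured : ℕ → List ℤ
punctured m = map (λ n → +[1+ n ]) (upTo m) ++ map (λ n → -[1+ n ]) (upTo m)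

interval : ℕ → List ℤ
interval m = + 0 ∷ punctured m

∈-punctured⁺ : ∀ {m} k → ∣ k ∣ ≤ m → k ≢ + 0 → k ∈ punctured m
∈-punctured⁺ (+ zero) _ k≢0 = contradiction refl k≢0
∈-punctured⁺ +[1+ n ] n<m _ = ∈-++⁺ˡ (∈-map⁺ _ (∈-upTo⁺ n<m))
∈-punctured⁺ {m} -[1+ n ] n<m _ = ∈-++⁺ʳ (map _ (upTo m)) (∈-map⁺ _ (∈-upTo⁺ n<m))

∈-punctured⁻ : ∀ {m k} → k ∈ punctured m → ∣ k ∣ ≤ m × k ≢ + 0
∈-punctured⁻ {m} p with ∈-++⁻ (map _ (upTo m)) p
... | inj₁ q with n , n∈ , refl ← ∈-map⁻ _ q = ∈-upTo⁻ n∈ , λ ()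
... | inj₂ q with n , n∈ , refl ← ∈-map⁻ _ q = ∈-upTo⁻ n∈ , λ ()

∈-interval⁺ : ∀ {m} k → ∣ k ∣ ≤ m → k ∈ interval m
∈-interval⁺ (+ zero) _ = here refl
∈-interval⁺ +[1+ n ] k≤m = there (∈-punctured⁺ +[1+ n ] k≤m λ ())
∈-interval⁺ -[1+ n ] k≤m = there (∈-punctured⁺ -[1+ n ] k≤m λ ())

∈-interval⁻ : ∀ {m k} → k ∈ interval m → ∣ k ∣ ≤ m
∈-interval⁻ (here refl) = z≤n
∈-interval⁻ (there p) = proj₁ (∈-punctured⁻ p)

punctured-unique : ∀ m → Unique (punctured m)
punctured-unique m = Unique.++⁺ (Unique.map⁺ (λ { refl → refl }) (Unique.upTo⁺ m))
                                (Unique.map⁺ (λ { refl → refl }) (Unique.upTo⁺ m))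
                                (λ (p , q) → case ∈-map⁻ _ p , ∈-map⁻ _ q of λ { ((_ , _ , refl) , (_ , _ , ())) })

interval-unique : ∀ m → Unique (interval m)
interval-unique m = All.tabulate (λ p eq → proj₂ (∈-punctured⁻ {m} p) (sym eq)) ∷ punctured-unique m

length-punctured : ∀ m → length (punctured m) ≡ m ℕ.+ m
length-punctured m = trans (List.length-++ (map _ (upTo m))) (cong₂ ℕ._+_ (length-map-upTo _) (length-map-upTo _))
  where
  length-map-upTo : ∀ (f : ℕ → ℤ) → length (map f (upTo m)) ≡ m
  length-map-upTo f = trans (List.length-map f (upTo m)) (List.length-upTo m)

xⁱy y⁻¹x⁻ⁱ : ℕ → Elt
xⁱy i = xyx (+ i) true (+ 0)
y⁻¹x⁻ⁱ i = xyx (+ 0) false (- + i)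

xⁱy-⁻¹ : ∀ i → ⟦ xⁱy i ⟧ ⁻¹ ≡ ⟦ y⁻¹x⁻ⁱ i ⟧
xⁱy-⁻¹ i = xyx-⁻¹ (+ i) true (+ 0)

xᵃy⁻¹x⁻ʲ : ℤ → ℕ → Elt
xᵃy⁻¹x⁻ʲ a j = xyx a false (- + j)

xⁱyxᵇ : ℕ → ℤ → Elt
xⁱyxᵇ i b = xyx (+ i) true b

xyx-injective : ∀ {a s b a′ s′ b′} → xyx a s b ≡ xyx a′ s′ b′ → a ≡ a′ × s ≡ s′ × b ≡ b′
xyx-injective refl = refl , refl , refl

Aᴱ : ℕ → List Elt
Aᴱ m = xPow (+ 0) ∷ xPow -[1+ 0 ] ∷ map xⁱy (upTo (suc m))

A : ℕ → List Word
A m = map ⟦_⟧ (Aᴱ m)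

data InA (m : ℕ) : Elt → Set where
  1∈A   : InA m (xPow (+ 0))
  x⁻¹∈A : InA m (xPow -[1+ 0 ])
  xⁱy∈A : ∀ {i} → i ≤ m → InA m (xⁱy i)

∈Aᴱ⇒InA : ∀ {m e} → e ∈ Aᴱ m → InA m e
∈Aᴱ⇒InA (here refl) = 1∈A
∈Aᴱ⇒InA (there (here refl)) = x⁻¹∈A
∈Aᴱ⇒InA (there (there p)) with i , i∈ , refl ← ∈-map⁻ xⁱy p = xⁱy∈A (ℕ.≤-pred (∈-upTo⁻ i∈))

InA⇒∈Aᴱ : ∀ {m e} → InA m e → e ∈ Aᴱ m
InA⇒∈Aᴱ 1∈A = here refl
InA⇒∈Aᴱ x⁻¹∈A = there (here refl)
InA⇒∈Aᴱ (xⁱy∈A i≤m) = there (there (∈-map⁺ xⁱy (∈-upTo⁺ (s≤s i≤m))))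

InA-reduced : ∀ {m e} → InA m e → IsReduced ⟦ e ⟧ × IsReduced (⟦ e ⟧ ⁻¹)
InA-reduced 1∈A = refl , refl
InA-reduced x⁻¹∈A = refl , refl
InA-reduced (xⁱy∈A {i} _) =
  xyx-reduced (+ i) true (+ 0) , subst IsReduced (sym (xⁱy-⁻¹ i)) (xyx-reduced (+ 0) false (- + i))

A-reduced : ∀ m → All IsReduced (A m)
A-reduced m = All.map⁺ (All.tabulate (λ p → proj₁ (InA-reduced (∈Aᴱ⇒InA p))))

A⁻¹-reduced : ∀ m → All IsReduced (map _⁻¹ (A m))
A⁻¹-reduced m = All.map⁺ (All.map⁺ (All.tabulate (λ p → proj₂ (InA-reduced (∈Aᴱ⇒InA p)))))

quotientʳ : ∀ {m e f} → InA m e → InA m f → Elt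
quotientʳ 1∈A 1∈A = xPow (+ 0)
quotientʳ 1∈A x⁻¹∈A = xPow (+ 1)
quotientʳ 1∈A (xⁱy∈A {j} _) = xᵃy⁻¹x⁻ʲ (+ 0) j
quotientʳ x⁻¹∈A 1∈A = xPow -[1+ 0 ]
quotientʳ x⁻¹∈A x⁻¹∈A = xPow (+ 0)
quotientʳ x⁻¹∈A (xⁱy∈A {j} _) = xᵃy⁻¹x⁻ʲ -[1+ 0 ] j
quotientʳ (xⁱy∈A {i} _) 1∈A = xⁱyxᵇ i (+ 0)
quotientʳ (xⁱy∈A {i} _) x⁻¹∈A = xⁱyxᵇ i (+ 1)
quotientʳ (xⁱy∈A {i} _) (xⁱy∈A {j} _) = xPow (i ⊖ j)

quotientʳ-correct : ∀ {m e f} (p : InA m e) (q : InA m f) → ⟦ e ⟧ · (⟦ f ⟧ ⁻¹) ≡ ⟦ quotientʳ p q ⟧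
quotientʳ-correct 1∈A 1∈A = refl
quotientʳ-correct 1∈A x⁻¹∈A = refl
quotientʳ-correct 1∈A (xⁱy∈A {j} _) = trans (cong ([] ·_) (xⁱy-⁻¹ j)) (xPow-·-xyx (+ 0) (+ 0) false (- + j))
quotientʳ-correct x⁻¹∈A 1∈A = refl
quotientʳ-correct x⁻¹∈A x⁻¹∈A = refl
quotientʳ-correct x⁻¹∈A (xⁱy∈A {j} _) =
  trans (cong (⟦ xPow -[1+ 0 ] ⟧ ·_) (xⁱy-⁻¹ j)) (xPow-·-xyx -[1+ 0 ] (+ 0) false (- + j))
quotientʳ-correct (xⁱy∈A {i} _) 1∈A = xyx-·-xPow (+ i) true (+ 0) (+ 0)
quotientʳ-correct (xⁱy∈A {i} _) x⁻¹∈A = xyx-·-xPow (+ i) true (+ 0) (+ 1)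
quotientʳ-correct (xⁱy∈A {i} _) (xⁱy∈A {j} _) = begin
  ⟦ xⁱy i ⟧ · (⟦ xⁱy j ⟧ ⁻¹)  ≡⟨ cong (⟦ xⁱy i ⟧ ·_) (xⁱy-⁻¹ j) ⟩
  ⟦ xⁱy i ⟧ · ⟦ y⁻¹x⁻ⁱ j ⟧    ≡⟨ xy-·-y⁻¹x (+ i) true (- + j) ⟩
  x^ (+ i + - + j)           ≡⟨ cong x^ (ℤ.m-n≡m⊖n i j) ⟩
  x^ (i ⊖ j)                 ∎

AA⁻¹ᴱ-xPow AA⁻¹ᴱ-y⁻¹ AA⁻¹ᴱ-y : ℕ → List Elt
AA⁻¹ᴱ-xPow m = map xPow (interval m)
AA⁻¹ᴱ-y⁻¹ m = cartesianProductWith xᵃy⁻¹x⁻ʲ (+ 0 ∷ -[1+ 0 ] ∷ []) (upTo (suc m))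
AA⁻¹ᴱ-y m = cartesianProductWith xⁱyxᵇ (upTo (suc m)) (+ 0 ∷ + 1 ∷ [])

AA⁻¹ᴱ-families : ℕ → List (List Elt)
AA⁻¹ᴱ-families m = AA⁻¹ᴱ-xPow m ∷ AA⁻¹ᴱ-y⁻¹ m ∷ AA⁻¹ᴱ-y m ∷ []

AA⁻¹ᴱ : ℕ → List Elt
AA⁻¹ᴱ m = concat (AA⁻¹ᴱ-families m)

quotientʳ∈AA⁻¹ᴱ : ∀ {m e f} → 1 ≤ m → (p : InA m e) (q : InA m f) → quotientʳ p q ∈ AA⁻¹ᴱ m
quotientʳ∈AA⁻¹ᴱ {m} 1≤m = table
  where
  member : ∀ {e F} → e ∈ F → F ∈ AA⁻¹ᴱ-families m → e ∈ AA⁻¹ᴱ m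
  member = ∈-concat⁺′
  power : ∀ k → ∣ k ∣ ≤ m → xPow k ∈ AA⁻¹ᴱ m
  power k k≤m = member (∈-map⁺ xPow (∈-interval⁺ k k≤m)) (here refl)
  y⁻¹-family : ∀ {a j} → a ∈ (+ 0 ∷ -[1+ 0 ] ∷ []) → j ≤ m → xᵃy⁻¹x⁻ʲ a j ∈ AA⁻¹ᴱ m
  y⁻¹-family a∈ j≤m =
    member (∈-cartesianProductWith⁺ xᵃy⁻¹x⁻ʲ a∈ (∈-upTo⁺ (s≤s j≤m))) (there (here refl))
  y-family : ∀ {i b} → i ≤ m → b ∈ (+ 0 ∷ + 1 ∷ []) → xⁱyxᵇ i b ∈ AA⁻¹ᴱ m
  y-family i≤m b∈ =
    member (∈-cartesianProductWith⁺ xⁱyxᵇ (∈-upTo⁺ (s≤s i≤m)) b∈) (there (there (here refl)))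
  table : ∀ {e f} (p : InA m e) (q : InA m f) → quotientʳ p q ∈ AA⁻¹ᴱ m
  table 1∈A 1∈A = power (+ 0) z≤n
  table 1∈A x⁻¹∈A = power (+ 1) 1≤m
  table 1∈A (xⁱy∈A j≤m) = y⁻¹-family (here refl) j≤m
  table x⁻¹∈A 1∈A = power -[1+ 0 ] 1≤m
  table x⁻¹∈A x⁻¹∈A = power (+ 0) z≤n
  table x⁻¹∈A (xⁱy∈A j≤m) = y⁻¹-family (there (here refl)) j≤m
  table (xⁱy∈A i≤m) 1∈A = y-family i≤m (here refl)
  table (xⁱy∈A i≤m) x⁻¹∈A = y-family i≤m (there (here refl))
  table (xⁱy∈A {i} i≤m) (xⁱy∈A {j} j≤m) =
    power (i ⊖ j) (ℕ.≤-trans (ℤ.∣m⊝n∣≤m⊔n i j) (ℕ.⊔-lub i≤m j≤m))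

quotientʳ∈rightQuot : ∀ {m e f} (p : InA m e) (q : InA m f) → ⟦ quotientʳ p q ⟧ ∈ rightQuot (A m)
quotientʳ∈rightQuot {m} p q = subst (_∈ rightQuot (A m)) (quotientʳ-correct p q)
  (∈-cartesianProductWith⁺ (λ a b → a · (b ⁻¹)) (∈-map⁺ ⟦_⟧ (InA⇒∈Aᴱ p)) (∈-map⁺ ⟦_⟧ (InA⇒∈Aᴱ q)))

AA⁻¹ᴱ⊆rightQuot : ∀ {m g} → g ∈ AA⁻¹ᴱ m → ⟦ g ⟧ ∈ rightQuot (A m)
AA⁻¹ᴱ⊆rightQuot {m} g∈ = family (∈-concat⁻ (AA⁻¹ᴱ-families m) g∈)
  where
  power : ∀ k → ∣ k ∣ ≤ m → ⟦ xPow k ⟧ ∈ rightQuot (A m)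
  power (+ n) n≤m = quotientʳ∈rightQuot (xⁱy∈A n≤m) (xⁱy∈A z≤n)
  power -[1+ n ] n<m = quotientʳ∈rightQuot (xⁱy∈A z≤n) (xⁱy∈A n<m)
  y⁻¹-family : ∀ {a j} → a ∈ (+ 0 ∷ -[1+ 0 ] ∷ []) → j < suc m → ⟦ xᵃy⁻¹x⁻ʲ a j ⟧ ∈ rightQuot (A m)
  y⁻¹-family (here refl) (s≤s j≤m) = quotientʳ∈rightQuot 1∈A (xⁱy∈A j≤m)
  y⁻¹-family (there (here refl)) (s≤s j≤m) = quotientʳ∈rightQuot x⁻¹∈A (xⁱy∈A j≤m)
  y-family : ∀ {i b} → i < suc m → b ∈ (+ 0 ∷ + 1 ∷ []) → ⟦ xⁱyxᵇ i b ⟧ ∈ rightQuot (A m)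
  y-family (s≤s i≤m) (here refl) = quotientʳ∈rightQuot (xⁱy∈A i≤m) 1∈A
  y-family (s≤s i≤m) (there (here refl)) = quotientʳ∈rightQuot (xⁱy∈A i≤m) x⁻¹∈A
  family : ∀ {g} → Any (g ∈_) (AA⁻¹ᴱ-families m) → ⟦ g ⟧ ∈ rightQuot (A m)
  family (here p) with k , k∈ , refl ← ∈-map⁻ xPow p = power k (∈-interval⁻ k∈)
  family (there (here p))
    with _ , _ , a∈ , j∈ , refl ← ∈-cartesianProductWith⁻ xᵃy⁻¹x⁻ʲ (+ 0 ∷ -[1+ 0 ] ∷ []) (upTo (suc m)) p =
    y⁻¹-family a∈ (∈-upTo⁻ j∈)
  family (there (there (here p)))
    with _ , _ , i∈ , b∈ , refl ← ∈-cartesianProductWith⁻ xⁱyxᵇ (upTo (suc m)) (+ 0 ∷ + 1 ∷ []) p =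
    y-family (∈-upTo⁻ i∈) b∈

AA⁻¹ᴱ-unique : ∀ m → Unique (AA⁻¹ᴱ m)
AA⁻¹ᴱ-unique m = Unique.concat⁺ (xPow-unique ∷ y⁻¹-unique ∷ y-unique ∷ [])
  ( (Disjoint-on yPattern xPow-tag y⁻¹-tag (λ ()) ∷ Disjoint-on yPattern xPow-tag y-tag (λ ()) ∷ [])
  ∷ (Disjoint-on yPattern y⁻¹-tag y-tag (λ ()) ∷ [])
  ∷ [] ∷ [])
  where
  pair-unique : ∀ {a b : ℤ} → a ≢ b → Unique (a ∷ b ∷ [])
  pair-unique a≢b = (a≢b ∷ []) ∷ [] ∷ []
  xPow-unique : Unique (AA⁻¹ᴱ-xPow m)
  xPow-unique = Unique.map⁺ (λ { refl → refl }) (interval-unique m)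
  y⁻¹-unique : Unique (AA⁻¹ᴱ-y⁻¹ m)
  y⁻¹-unique = Unique.cartesianProductWith⁺ xᵃy⁻¹x⁻ʲ
    (λ eq → let a≡a′ , _ , j≡j′ = xyx-injective eq in a≡a′ , ℤ.+-injective (ℤ.neg-injective j≡j′))
    (pair-unique λ ()) (Unique.upTo⁺ (suc m))
  y-unique : Unique (AA⁻¹ᴱ-y m)
  y-unique = Unique.cartesianProductWith⁺ xⁱyxᵇ
    (λ eq → let i≡i′ , _ , b≡b′ = xyx-injective eq in ℤ.+-injective i≡i′ , b≡b′)
    (Unique.upTo⁺ (suc m)) (pair-unique λ ())
  xPow-tag : All (λ e → yPattern e ≡ []) (AA⁻¹ᴱ-xPow m)
  xPow-tag = All-map⁺ xPow (λ _ → refl) (interval m)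
  y⁻¹-tag : All (λ e → yPattern e ≡ false ∷ []) (AA⁻¹ᴱ-y⁻¹ m)
  y⁻¹-tag = All-cartesianProductWith⁺ xᵃy⁻¹x⁻ʲ (λ _ _ → refl) (+ 0 ∷ -[1+ 0 ] ∷ []) (upTo (suc m))
  y-tag : All (λ e → yPattern e ≡ true ∷ []) (AA⁻¹ᴱ-y m)
  y-tag = All-cartesianProductWith⁺ xⁱyxᵇ (λ _ _ → refl) (upTo (suc m)) (+ 0 ∷ + 1 ∷ [])

length-AA⁻¹ᴱ : ∀ m → length (AA⁻¹ᴱ m) ≡ 6 ℕ.* m ℕ.+ 5
length-AA⁻¹ᴱ m = begin
  length (AA⁻¹ᴱ m)
    ≡⟨ length-concat (AA⁻¹ᴱ-families m) ⟩
  length (AA⁻¹ᴱ-xPow m) ℕ.+ (length (AA⁻¹ᴱ-y⁻¹ m) ℕ.+ (length (AA⁻¹ᴱ-y m) ℕ.+ 0))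
    ≡⟨ cong₂ ℕ._+_ xPow-length (cong₂ ℕ._+_ y⁻¹-length (cong (ℕ._+ 0) y-length)) ⟩
  suc (m ℕ.+ m) ℕ.+ (2 ℕ.* suc m ℕ.+ (suc m ℕ.* 2 ℕ.+ 0))
    ≡⟨ arithmetic m ⟩
  6 ℕ.* m ℕ.+ 5
    ∎
  where
  arithmetic : ∀ m → suc (m ℕ.+ m) ℕ.+ (2 ℕ.* suc m ℕ.+ (suc m ℕ.* 2 ℕ.+ 0)) ≡ 6 ℕ.* m ℕ.+ 5
  arithmetic = solve-∀
  xPow-length : length (AA⁻¹ᴱ-xPow m) ≡ suc (m ℕ.+ m)
  xPow-length = trans (List.length-map xPow (interval m)) (cong suc (length-punctured m))
  y⁻¹-length : length (AA⁻¹ᴱ-y⁻¹ m) ≡ 2 ℕ.* suc m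
  y⁻¹-length = trans (length-cartesianProductWith xᵃy⁻¹x⁻ʲ (+ 0 ∷ -[1+ 0 ] ∷ []) (upTo (suc m)))
                     (cong (2 ℕ.*_) (List.length-upTo (suc m)))
  y-length : length (AA⁻¹ᴱ-y m) ≡ suc m ℕ.* 2
  y-length = trans (length-cartesianProductWith xⁱyxᵇ (upTo (suc m)) (+ 0 ∷ + 1 ∷ []))
                   (cong (ℕ._* 2) (List.length-upTo (suc m)))

rightQuot⊆AA⁻¹ᴱ : ∀ {m z} → 1 ≤ m → z ∈ rightQuot (A m) → z ∈ map ⟦_⟧ (AA⁻¹ᴱ m)
rightQuot⊆AA⁻¹ᴱ {m} 1≤m z∈ with _ , _ , e∈ , f∈ , refl ← ∈-cartesianProductWith-map⁻ (Aᴱ m) (Aᴱ m) z∈ =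
  let p = ∈Aᴱ⇒InA e∈ ; q = ∈Aᴱ⇒InA f∈ in
  subst (_∈ map ⟦_⟧ (AA⁻¹ᴱ m)) (sym (quotientʳ-correct p q)) (∈-map⁺ ⟦_⟧ (quotientʳ∈AA⁻¹ᴱ 1≤m p q))

card-rightQuot : ∀ m → 1 ≤ m → card (rightQuot (A m)) ≡ 6 ℕ.* m ℕ.+ 5
card-rightQuot m 1≤m = begin
  card (rightQuot (A m))
    ≡⟨ card-≡-length (rightQuot (A m)) (Unique.map⁺ ⟦⟧-injective (AA⁻¹ᴱ-unique m))
                     (rightQuot⊆AA⁻¹ᴱ 1≤m) AA⁻¹ᴱ⊆ ⟩
  length (map ⟦_⟧ (AA⁻¹ᴱ m))  ≡⟨ List.length-map ⟦_⟧ (AA⁻¹ᴱ m) ⟩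
  length (AA⁻¹ᴱ m)            ≡⟨ length-AA⁻¹ᴱ m ⟩
  6 ℕ.* m ℕ.+ 5               ∎
  where
  AA⁻¹ᴱ⊆ : ∀ {z} → z ∈ map ⟦_⟧ (AA⁻¹ᴱ m) → z ∈ rightQuot (A m)
  AA⁻¹ᴱ⊆ z∈ with _ , g∈ , refl ← ∈-map⁻ ⟦_⟧ z∈ = AA⁻¹ᴱ⊆rightQuot g∈

quotientˡ : ∀ {m e f} → InA m e → InA m f → Elt
quotientˡ 1∈A 1∈A = xPow (+ 0)
quotientˡ 1∈A x⁻¹∈A = xPow -[1+ 0 ]
quotientˡ 1∈A (xⁱy∈A {j} _) = xⁱy j
quotientˡ x⁻¹∈A 1∈A = xPow (+ 1)
quotientˡ x⁻¹∈A x⁻¹∈A = xPow (+ 0)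
quotientˡ x⁻¹∈A (xⁱy∈A {j} _) = xⁱy (suc j)
quotientˡ (xⁱy∈A {i} _) 1∈A = y⁻¹x⁻ⁱ i
quotientˡ (xⁱy∈A {i} _) x⁻¹∈A = y⁻¹x⁻ⁱ (suc i)
quotientˡ (xⁱy∈A {i} _) (xⁱy∈A {j} _) = yConj (j ⊖ i)

quotientˡ-correct : ∀ {m e f} (p : InA m e) (q : InA m f) → (⟦ e ⟧ ⁻¹) · ⟦ f ⟧ ≡ ⟦ quotientˡ p q ⟧
quotientˡ-correct 1∈A 1∈A = refl
quotientˡ-correct 1∈A x⁻¹∈A = refl
quotientˡ-correct 1∈A (xⁱy∈A {j} _) = xPow-·-xyx (+ 0) (+ j) true (+ 0)
quotientˡ-correct x⁻¹∈A 1∈A = refl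
quotientˡ-correct x⁻¹∈A x⁻¹∈A = refl
quotientˡ-correct x⁻¹∈A (xⁱy∈A {j} _) = xPow-·-xyx (+ 1) (+ j) true (+ 0)
quotientˡ-correct (xⁱy∈A {i} _) 1∈A = begin
  (⟦ xⁱy i ⟧ ⁻¹) · []                ≡⟨ cong (_· []) (xⁱy-⁻¹ i) ⟩
  ⟦ y⁻¹x⁻ⁱ i ⟧ · []                  ≡⟨ xyx-·-xPow (+ 0) false (- + i) (+ 0) ⟩
  ⟦ xyx (+ 0) false (- + i + + 0) ⟧  ≡⟨ cong (λ k → ⟦ xyx (+ 0) false k ⟧) (ℤ.+-identityʳ (- + i)) ⟩
  ⟦ y⁻¹x⁻ⁱ i ⟧                       ∎
quotientˡ-correct (xⁱy∈A {i} _) x⁻¹∈A = begin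
  (⟦ xⁱy i ⟧ ⁻¹) · ⟦ xPow -[1+ 0 ] ⟧         ≡⟨ cong (_· ⟦ xPow -[1+ 0 ] ⟧) (xⁱy-⁻¹ i) ⟩
  ⟦ y⁻¹x⁻ⁱ i ⟧ · ⟦ xPow -[1+ 0 ] ⟧           ≡⟨ xyx-·-xPow (+ 0) false (- + i) -[1+ 0 ] ⟩
  ⟦ xyx (+ 0) false (- + i + -[1+ 0 ]) ⟧     ≡⟨ cong (λ k → ⟦ xyx (+ 0) false k ⟧) (-i-1≡-[1+i] i) ⟩
  ⟦ y⁻¹x⁻ⁱ (suc i) ⟧                         ∎
  where
  -i-1≡-[1+i] : ∀ i → - + i + -[1+ 0 ] ≡ -[1+ i ]
  -i-1≡-[1+i] zero = refl
  -i-1≡-[1+i] (suc n) = cong (λ k → -[1+ suc k ]) (ℕ.+-identityʳ n)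
quotientˡ-correct (xⁱy∈A {i} _) (xⁱy∈A {j} _) = begin
  (⟦ xⁱy i ⟧ ⁻¹) · ⟦ xⁱy j ⟧  ≡⟨ cong (_· ⟦ xⁱy j ⟧) (xⁱy-⁻¹ i) ⟩
  ⟦ y⁻¹x⁻ⁱ i ⟧ · ⟦ xⁱy j ⟧    ≡⟨ y⁻¹x-·-xy (- + i) (+ j) ⟩
  ⟦ yConj (- + i + + j) ⟧     ≡⟨ cong (λ k → ⟦ yConj k ⟧) (ℤ.-m+n≡n⊖m i j) ⟩
  ⟦ yConj (j ⊖ i) ⟧           ∎

A⁻¹Aᴱ-xPow : List Elt
A⁻¹Aᴱ-xPow = map xPow (interval 1)

A⁻¹Aᴱ-y A⁻¹Aᴱ-y⁻¹ A⁻¹Aᴱ-yxy : ℕ → List Elt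
A⁻¹Aᴱ-y m = map xⁱy (upTo (2 ℕ.+ m))
A⁻¹Aᴱ-y⁻¹ m = map y⁻¹x⁻ⁱ (upTo (2 ℕ.+ m))
A⁻¹Aᴱ-yxy m = map yxy (punctured m)

A⁻¹Aᴱ-families : ℕ → List (List Elt)
A⁻¹Aᴱ-families m = A⁻¹Aᴱ-xPow ∷ A⁻¹Aᴱ-y m ∷ A⁻¹Aᴱ-y⁻¹ m ∷ A⁻¹Aᴱ-yxy m ∷ []

A⁻¹Aᴱ : ℕ → List Elt
A⁻¹Aᴱ m = concat (A⁻¹Aᴱ-families m)

quotientˡ∈A⁻¹Aᴱ : ∀ {m e f} (p : InA m e) (q : InA m f) → quotientˡ p q ∈ A⁻¹Aᴱ m
quotientˡ∈A⁻¹Aᴱ {m} = table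
  where
  member : ∀ {e F} → e ∈ F → F ∈ A⁻¹Aᴱ-families m → e ∈ A⁻¹Aᴱ m
  member = ∈-concat⁺′
  power : ∀ k → ∣ k ∣ ≤ 1 → xPow k ∈ A⁻¹Aᴱ m
  power k k≤1 = member (∈-map⁺ xPow (∈-interval⁺ k k≤1)) (here refl)
  y-family : ∀ {k} → k < 2 ℕ.+ m → xⁱy k ∈ A⁻¹Aᴱ m
  y-family k< = member (∈-map⁺ xⁱy (∈-upTo⁺ k<)) (there (here refl))
  y⁻¹-family : ∀ {k} → k < 2 ℕ.+ m → y⁻¹x⁻ⁱ k ∈ A⁻¹Aᴱ m
  y⁻¹-family k< = member (∈-map⁺ y⁻¹x⁻ⁱ (∈-upTo⁺ k<)) (there (there (here refl)))
  conjugate : ∀ k → ∣ k ∣ ≤ m → yConj k ∈ A⁻¹Aᴱ m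
  conjugate (+ zero) _ = power (+ 0) z≤n
  conjugate +[1+ n ] k≤m =
    member (∈-map⁺ yxy (∈-punctured⁺ +[1+ n ] k≤m λ ())) (there (there (there (here refl))))
  conjugate -[1+ n ] k≤m =
    member (∈-map⁺ yxy (∈-punctured⁺ -[1+ n ] k≤m λ ())) (there (there (there (here refl))))
  table : ∀ {e f} (p : InA m e) (q : InA m f) → quotientˡ p q ∈ A⁻¹Aᴱ m
  table 1∈A 1∈A = power (+ 0) z≤n
  table 1∈A x⁻¹∈A = power -[1+ 0 ] ℕ.≤-refl
  table 1∈A (xⁱy∈A j≤m) = y-family (s≤s (ℕ.m≤n⇒m≤1+n j≤m))
  table x⁻¹∈A 1∈A = power (+ 1) ℕ.≤-refl
  table x⁻¹∈A x⁻¹∈A = power (+ 0) z≤n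
  table x⁻¹∈A (xⁱy∈A j≤m) = y-family (s≤s (s≤s j≤m))
  table (xⁱy∈A i≤m) 1∈A = y⁻¹-family (s≤s (ℕ.m≤n⇒m≤1+n i≤m))
  table (xⁱy∈A i≤m) x⁻¹∈A = y⁻¹-family (s≤s (s≤s i≤m))
  table (xⁱy∈A {i} i≤m) (xⁱy∈A {j} j≤m) =
    conjugate (j ⊖ i) (ℕ.≤-trans (ℤ.∣m⊝n∣≤m⊔n j i) (ℕ.⊔-lub j≤m i≤m))

quotientˡ∈leftQuot : ∀ {m e f} (p : InA m e) (q : InA m f) → ⟦ quotientˡ p q ⟧ ∈ leftQuot (A m)
quotientˡ∈leftQuot {m} p q = subst (_∈ leftQuot (A m)) (quotientˡ-correct p q)
  (∈-cartesianProductWith⁺ (λ a b → (a ⁻¹) · b) (∈-map⁺ ⟦_⟧ (InA⇒∈Aᴱ p)) (∈-map⁺ ⟦_⟧ (InA⇒∈Aᴱ q)))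

A⁻¹Aᴱ⊆leftQuot : ∀ {m g} → g ∈ A⁻¹Aᴱ m → ⟦ g ⟧ ∈ leftQuot (A m)
A⁻¹Aᴱ⊆leftQuot {m} g∈ = family (∈-concat⁻ (A⁻¹Aᴱ-families m) g∈)
  where
  power : ∀ k → ∣ k ∣ ≤ 1 → ⟦ xPow k ⟧ ∈ leftQuot (A m)
  power (+ zero) _ = quotientˡ∈leftQuot 1∈A 1∈A
  power (+ 1) _ = quotientˡ∈leftQuot x⁻¹∈A 1∈A
  power -[1+ zero ] _ = quotientˡ∈leftQuot 1∈A x⁻¹∈A
  power (+ suc (suc _)) (s≤s ())
  power -[1+ suc _ ] (s≤s ())
  y-family : ∀ {k} → k < 2 ℕ.+ m → ⟦ xⁱy k ⟧ ∈ leftQuot (A m)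
  y-family {zero} _ = quotientˡ∈leftQuot 1∈A (xⁱy∈A z≤n)
  y-family {suc k} (s≤s (s≤s k≤m)) = quotientˡ∈leftQuot x⁻¹∈A (xⁱy∈A k≤m)
  y⁻¹-family : ∀ {k} → k < 2 ℕ.+ m → ⟦ y⁻¹x⁻ⁱ k ⟧ ∈ leftQuot (A m)
  y⁻¹-family {zero} _ = quotientˡ∈leftQuot (xⁱy∈A z≤n) 1∈A
  y⁻¹-family {suc k} (s≤s (s≤s k≤m)) = quotientˡ∈leftQuot (xⁱy∈A k≤m) x⁻¹∈A
  conjugate : ∀ k → ∣ k ∣ ≤ m → k ≢ + 0 → ⟦ yxy k ⟧ ∈ leftQuot (A m)
  conjugate (+ zero) _ k≢0 = contradiction refl k≢0
  conjugate +[1+ n ] k≤m _ = quotientˡ∈leftQuot (xⁱy∈A z≤n) (xⁱy∈A k≤m)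
  conjugate -[1+ n ] k≤m _ = quotientˡ∈leftQuot (xⁱy∈A k≤m) (xⁱy∈A z≤n)
  family : ∀ {g} → Any (g ∈_) (A⁻¹Aᴱ-families m) → ⟦ g ⟧ ∈ leftQuot (A m)
  family (here p) with k , k∈ , refl ← ∈-map⁻ xPow p = power k (∈-interval⁻ k∈)
  family (there (here p)) with _ , k∈ , refl ← ∈-map⁻ xⁱy p = y-family (∈-upTo⁻ k∈)
  family (there (there (here p))) with _ , k∈ , refl ← ∈-map⁻ y⁻¹x⁻ⁱ {xs = upTo (2 ℕ.+ m)} p =
    y⁻¹-family (∈-upTo⁻ k∈)
  family (there (there (there (here p)))) with k , k∈ , refl ← ∈-map⁻ yxy p =
    let k≤m , k≢0 = ∈-punctured⁻ k∈ in conjugate k k≤m k≢0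

A⁻¹Aᴱ-unique : ∀ m → Unique (A⁻¹Aᴱ m)
A⁻¹Aᴱ-unique m = Unique.concat⁺ (xPow-unique ∷ y-unique ∷ y⁻¹-unique ∷ yxy-unique ∷ [])
  ( (Disjoint-on yPattern xPow-tag y-tag (λ ()) ∷ Disjoint-on yPattern xPow-tag y⁻¹-tag (λ ())
      ∷ Disjoint-on yPattern xPow-tag yxy-tag (λ ()) ∷ [])
  ∷ (Disjoint-on yPattern y-tag y⁻¹-tag (λ ()) ∷ Disjoint-on yPattern y-tag yxy-tag (λ ()) ∷ [])
  ∷ (Disjoint-on yPattern y⁻¹-tag yxy-tag (λ ()) ∷ [])
  ∷ [] ∷ [])
  where
  xPow-unique : Unique A⁻¹Aᴱ-xPow
  xPow-unique = Unique.map⁺ {f = xPow} (λ { refl → refl }) (interval-unique 1)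
  y-unique : Unique (A⁻¹Aᴱ-y m)
  y-unique = Unique.map⁺ (λ eq → ℤ.+-injective (proj₁ (xyx-injective eq))) (Unique.upTo⁺ (2 ℕ.+ m))
  y⁻¹-unique : Unique (A⁻¹Aᴱ-y⁻¹ m)
  y⁻¹-unique = Unique.map⁺ (λ eq → ℤ.+-injective (ℤ.neg-injective (proj₂ (proj₂ (xyx-injective eq)))))
                           (Unique.upTo⁺ (2 ℕ.+ m))
  yxy-unique : Unique (A⁻¹Aᴱ-yxy m)
  yxy-unique = Unique.map⁺ (λ { refl → refl }) (punctured-unique m)
  xPow-tag : All (λ e → yPattern e ≡ []) A⁻¹Aᴱ-xPow
  xPow-tag = All-map⁺ xPow (λ _ → refl) (interval 1)
  y-tag : All (λ e → yPattern e ≡ true ∷ []) (A⁻¹Aᴱ-y m)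
  y-tag = All-map⁺ xⁱy (λ _ → refl) (upTo (2 ℕ.+ m))
  y⁻¹-tag : All (λ e → yPattern e ≡ false ∷ []) (A⁻¹Aᴱ-y⁻¹ m)
  y⁻¹-tag = All-map⁺ y⁻¹x⁻ⁱ (λ _ → refl) (upTo (2 ℕ.+ m))
  yxy-tag : All (λ e → yPattern e ≡ false ∷ true ∷ []) (A⁻¹Aᴱ-yxy m)
  yxy-tag = All-map⁺ yxy (λ _ → refl) (punctured m)

length-A⁻¹Aᴱ : ∀ m → length (A⁻¹Aᴱ m) ≡ 4 ℕ.* m ℕ.+ 7
length-A⁻¹Aᴱ m = begin
  length (A⁻¹Aᴱ m)
    ≡⟨ length-concat (A⁻¹Aᴱ-families m) ⟩
  3 ℕ.+ (length (A⁻¹Aᴱ-y m) ℕ.+ (length (A⁻¹Aᴱ-y⁻¹ m) ℕ.+ (length (A⁻¹Aᴱ-yxy m) ℕ.+ 0)))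
    ≡⟨ cong (3 ℕ.+_) (cong₂ ℕ._+_ y-length (cong₂ ℕ._+_ y⁻¹-length (cong (ℕ._+ 0) yxy-length))) ⟩
  3 ℕ.+ ((2 ℕ.+ m) ℕ.+ ((2 ℕ.+ m) ℕ.+ ((m ℕ.+ m) ℕ.+ 0)))
    ≡⟨ arithmetic m ⟩
  4 ℕ.* m ℕ.+ 7
    ∎
  where
  arithmetic : ∀ m → 3 ℕ.+ ((2 ℕ.+ m) ℕ.+ ((2 ℕ.+ m) ℕ.+ ((m ℕ.+ m) ℕ.+ 0))) ≡ 4 ℕ.* m ℕ.+ 7
  arithmetic = solve-∀
  y-length : length (A⁻¹Aᴱ-y m) ≡ 2 ℕ.+ m
  y-length = trans (List.length-map xⁱy (upTo (2 ℕ.+ m))) (List.length-upTo (2 ℕ.+ m))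
  y⁻¹-length : length (A⁻¹Aᴱ-y⁻¹ m) ≡ 2 ℕ.+ m
  y⁻¹-length = trans (List.length-map y⁻¹x⁻ⁱ (upTo (2 ℕ.+ m))) (List.length-upTo (2 ℕ.+ m))
  yxy-length : length (A⁻¹Aᴱ-yxy m) ≡ m ℕ.+ m
  yxy-length = trans (List.length-map yxy (punctured m)) (length-punctured m)

leftQuot⊆A⁻¹Aᴱ : ∀ {m z} → z ∈ leftQuot (A m) → z ∈ map ⟦_⟧ (A⁻¹Aᴱ m)
leftQuot⊆A⁻¹Aᴱ {m} z∈ with _ , _ , e∈ , f∈ , refl ← ∈-cartesianProductWith-map⁻ (Aᴱ m) (Aᴱ m) z∈ =
  let p = ∈Aᴱ⇒InA e∈ ; q = ∈Aᴱ⇒InA f∈ in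
  subst (_∈ map ⟦_⟧ (A⁻¹Aᴱ m)) (sym (quotientˡ-correct p q)) (∈-map⁺ ⟦_⟧ (quotientˡ∈A⁻¹Aᴱ p q))

card-leftQuot : ∀ m → card (leftQuot (A m)) ≡ 4 ℕ.* m ℕ.+ 7
card-leftQuot m = begin
  card (leftQuot (A m))
    ≡⟨ card-≡-length (leftQuot (A m)) (Unique.map⁺ ⟦⟧-injective (A⁻¹Aᴱ-unique m)) leftQuot⊆A⁻¹Aᴱ A⁻¹Aᴱ⊆ ⟩
  length (map ⟦_⟧ (A⁻¹Aᴱ m))  ≡⟨ List.length-map ⟦_⟧ (A⁻¹Aᴱ m) ⟩
  length (A⁻¹Aᴱ m)            ≡⟨ length-A⁻¹Aᴱ m ⟩
  4 ℕ.* m ℕ.+ 7               ∎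
  where
  A⁻¹Aᴱ⊆ : ∀ {z} → z ∈ map ⟦_⟧ (A⁻¹Aᴱ m) → z ∈ leftQuot (A m)
  A⁻¹Aᴱ⊆ z∈ with _ , g∈ , refl ← ∈-map⁻ ⟦_⟧ z∈ = A⁻¹Aᴱ⊆leftQuot g∈

card-difference : ∀ k → card (rightQuot (A (suc k))) ≡ card (leftQuot (A (suc k))) ℕ.+ 2 ℕ.* k
card-difference k = begin
  card (rightQuot (A (suc k)))                   ≡⟨ card-rightQuot (suc k) (s≤s z≤n) ⟩
  6 ℕ.* suc k ℕ.+ 5                              ≡⟨ arithmetic k ⟩
  (4 ℕ.* suc k ℕ.+ 7) ℕ.+ 2 ℕ.* k                ≡⟨ cong (ℕ._+ 2 ℕ.* k) (card-leftQuot (suc k)) ⟨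
  card (leftQuot (A (suc k))) ℕ.+ 2 ℕ.* k        ∎
  where
  arithmetic : ∀ k → 6 ℕ.* suc k ℕ.+ 5 ≡ (4 ℕ.* suc k ℕ.+ 7) ℕ.+ 2 ℕ.* k
  arithmetic = solve-∀

rightQuot-⁻¹ : ∀ ws → rightQuot (map _⁻¹ ws) ≡ leftQuot ws
rightQuot-⁻¹ ws = cartesianProductWith-map (λ a b → cong ((a ⁻¹) ·_) (⁻¹-involutive b)) ws ws

leftQuot-⁻¹ : ∀ ws → leftQuot (map _⁻¹ ws) ≡ rightQuot ws
leftQuot-⁻¹ ws = cartesianProductWith-map (λ a b → cong (_· (b ⁻¹)) (⁻¹-involutive a)) ws ws

+[m+n]-+m≡+n : ∀ m n → + (m ℕ.+ n) - + m ≡ + n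
+[m+n]-+m≡+n m n = trans (ℤ.m-n≡m⊖n (m ℕ.+ n) m) (trans (ℤ.⊖-≥ (ℕ.m≤m+n m n)) (cong +_ (ℕ.m+n∸m≡n m n)))

+m-+[m+n]≡-+n : ∀ m n → + m - + (m ℕ.+ n) ≡ - + n
+m-+[m+n]≡-+n m n = begin
  + m - + (m ℕ.+ n)  ≡⟨ ℤ.m-n≡m⊖n m (m ℕ.+ n) ⟩
  m ⊖ (m ℕ.+ n)      ≡⟨ ℤ.⊖-swap m (m ℕ.+ n) ⟩
  - ((m ℕ.+ n) ⊖ m)  ≡⟨ cong -_ (trans (sym (ℤ.m-n≡m⊖n (m ℕ.+ n) m)) (+[m+n]-+m≡+n m n)) ⟩
  - + n              ∎

theorem1p5 : (n : ℤ) → Σ FinSubsetF₂ (λ A → (+ card (rightQuot (proj₁ A))) - (+ card (leftQuot (proj₁ A))) ≡ + 2 * n)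
theorem1p5 (+ t) = (A (suc t) , A-reduced (suc t)) , (begin
  + card (rightQuot (A (suc t))) - + L                ≡⟨ cong (λ r → + r - + L) (card-difference t) ⟩
  + (L ℕ.+ 2 ℕ.* t) - + L                             ≡⟨ +[m+n]-+m≡+n L (2 ℕ.* t) ⟩
  + (2 ℕ.* t)                                         ≡⟨ ℤ.pos-* 2 t ⟩
  + 2 * + t                                           ∎)
  where L = card (leftQuot (A (suc t)))
theorem1p5 -[1+ t ] = (map _⁻¹ (A m) , A⁻¹-reduced m) , (begin
  + card (rightQuot (map _⁻¹ (A m))) - + card (leftQuot (map _⁻¹ (A m)))
    ≡⟨ cong₂ (λ r l → + card r - + card l) (rightQuot-⁻¹ (A m)) (leftQuot-⁻¹ (A m)) ⟩
  + L - + card (rightQuot (A m))                      ≡⟨ cong (λ r → + L - + r) (card-difference (suc t)) ⟩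
  + L - + (L ℕ.+ 2 ℕ.* suc t)                         ≡⟨ +m-+[m+n]≡-+n L (2 ℕ.* suc t) ⟩
  - + (2 ℕ.* suc t)                                   ≡⟨⟩
  + 2 * -[1+ t ]                                      ∎)
  where
  m = suc (suc t)
  L = card (leftQuot (A m))
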